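{- Let $n,m\ge1$, $d=n+\binom n2$. Suppose agents $b\in[m]$ have valuations $v^b$ that bid on cliques $K_{S^b}$, $S^b\subseteq[n]$, forming a covering, i.e. $\bigcup_{b=1}^m S^b=[n]$. Then for every bundle $a^*\in\{0,1\}^n$ there is a competitive equilibrium with anonymous graphical pricing at $a^*$: there exist $p\in\mathbb{R}^d$ and $a^1,\dots,a^m\in\{a_S:S\subseteq[n]\}$ with $a^b\in D(v^b,p)$ for all $b$ and $\pi\big(\sum_b a^b\big)=a^*$.
   Context: Vectors in $\mathbb{R}^d$ are indexed by $[n]\sqcup\binom{[n]}{2}$. For $S\subseteq[n]$, $a_S\in\{0,1\}^d$ has $a_{S,i}=1$ iff $i\in S$ and $a_{S,ij}=1$ iff $i,j\in S$. An agent bids on the clique $K_{S^b}$ if their valuation is $v^b(S)=\sum_{i\in S}w^b_i+\sum_{\{i,j\}\subseteq S}w^b_{ij}$ for $S\subseteq S^b$, with real weights $w^b$ on the vertices and edges of $K_{S^b}$, and $v^b(S)=-\infty$ whenever $S\not\subseteq S^b$ (weight $-\infty$ on vertices outside $S^b$). A price $p\in\mathbb{R}^d$ charges every agent $\langle p,a_S\rangle$ for bundle $S$. $D(v,p)=\{a_S: S\in\arg\max_{S\subseteq[n]}(v(S)-\langle p,a_S\rangle)\}$. $\pi:\mathbb{R}^d\to\mathbb{R}^n$ is projection onto the vertex coordinates. -}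

module Defs where

open import Level using (Level; _⊔_) renaming (suc to lsuc)
open import Data.Bool using (Bool; true; false; _∧_; if_then_else_)
open import Data.Nat as ℕ using (ℕ; zero; suc)
open import Data.Fin using (Fin; zero; suc; _<_; _<?_)
open import Data.Fin.Subset using (Subset; _∈_; _⊆_)
open import Data.Vec using (lookup)
open import Data.Product using (Σ; _×_; _,_; ∃)
open import Data.Sum using (_⊎_; inj₁; inj₂)
open import Data.Unit.Polymorphic using (⊤)
open import Data.Empty.Polymorphic using (⊥)
open import Relation.Nullary using (¬_; yes; no)
open import Relation.Binary using (Rel; IsTotalOrder)
open import Algebra.Bundles using (CommutativeRing)
open import Data.Fin.Subset.Properties using (_⊆?_)

-- Ordered fields (the standard library has no real numbers; the theorem
-- is stated for an arbitrary ordered field, of which ℝ is an instance).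

record OrderedField c ℓ₁ ℓ₂ : Set (lsuc (c ⊔ ℓ₁ ⊔ ℓ₂)) where
  field
    commutativeRing : CommutativeRing c ℓ₁
  open CommutativeRing commutativeRing public
  field
    _≤_          : Rel Carrier ℓ₂
    isTotalOrder : IsTotalOrder _≈_ _≤_
    +-mono-≤     : ∀ {x y} z → x ≤ y → (x + z) ≤ (y + z)
    *-nonneg     : ∀ {x y} → 0# ≤ x → 0# ≤ y → 0# ≤ (x * y)
    0≉1          : ¬ (0# ≈ 1#)
    inverse      : ∀ x → ¬ (x ≈ 0#) → Σ Carrier (λ y → (x * y) ≈ 1#)

-- Coordinates of ℝ^d, d = n + (n choose 2): [n] ⊔ (pairs i < j).

Edge : ℕ → Set
Edge n = Σ (Fin n × Fin n) (λ { (i , j) → i < j })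

Idx : ℕ → Set
Idx n = Fin n ⊎ Edge n

aS : ∀ {n} → Subset n → Idx n → Bool
aS S (inj₁ i) = lookup S i
aS S (inj₂ ((i , j) , _)) = lookup S i ∧ lookup S j

module _ {c ℓ₁ ℓ₂} (F : OrderedField c ℓ₁ ℓ₂) where
  open OrderedField F using (Carrier; _≤_; _+_; _-_; 0#)

  sumFin : ∀ n → (Fin n → Carrier) → Carrier
  sumFin zero    f = 0#
  sumFin (suc n) f = f zero + sumFin n (λ i → f (suc i))

  sumIdx : ∀ n → (Idx n → Carrier) → Carrier
  sumIdx n f = sumFin n (λ i → f (inj₁ i))
             + sumFin n (λ i → sumFin n (λ j → edgeTerm i j))
    where
    edgeTerm : Fin n → Fin n → Carrier
    edgeTerm i j with i <? j
    ... | yes i<j = f (inj₂ ((i , j) , i<j))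
    ... | no  _   = 0#

  pair : ∀ {n} → (Idx n → Carrier) → (Idx n → Bool) → Carrier
  pair {n} x a = sumIdx n (λ k → if a k then x k else 0#)

  data Ext : Set c where
    -∞  : Ext
    fin : Carrier → Ext

  _≤ₑ_ : Ext → Ext → Set ℓ₂
  -∞    ≤ₑ _     = ⊤
  fin x ≤ₑ -∞    = ⊥
  fin x ≤ₑ fin y = x ≤ y

  -- An agent bidding on the clique K_{Sb} with weights w (only the weights
  -- of vertices/edges of K_{Sb} matter):
  -- v(S) = ⟨w , a_S⟩ if S ⊆ Sb, and -∞ otherwise.
  record CliqueValuation (n : ℕ) : Set c where
    field
      Sb : Subset n
      w  : Idx n → Carrier

  valuation : ∀ {n} → CliqueValuation n → Subset n → Ext
  valuation v S with S ⊆? CliqueValuation.Sb v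
  ... | yes _ = fin (pair (CliqueValuation.w v) (aS S))
  ... | no  _ = -∞

  utility : ∀ {n} → CliqueValuation n → (Idx n → Carrier) → Subset n → Ext
  utility v p S with valuation v S
  ... | -∞    = -∞
  ... | fin x = fin (x - pair p (aS S))

  InDemand : ∀ {n} → CliqueValuation n → (Idx n → Carrier) → Subset n → Set ℓ₂
  InDemand {n} v p S = ∀ (T : Subset n) → utility v p T ≤ₑ utility v p S

-- number of b ∈ [m] with i ∈ T b, i.e. the i-th coordinate of π(Σ_b a_{T b})
count : ∀ {n} m → (Fin m → Subset n) → Fin n → ℕ
count zero    T i = 0
count (suc m) T i = (if lookup (T zero) i then 1 else 0) ℕ.+ count m (λ b → T (suc b)) i

bit : Bool → ℕ
bit true  = 1
bit false = 0

-- Partition a* into classes, each inside some agent's clique, such that no clique contains two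
-- classes: add the agents one at a time, the new agent swallowing every class inside its clique
-- together with the points only it covers. Give each class to the agent whose clique contains it
-- and who values it most; since no clique contains two classes, no agent gets two. Price every
-- vertex and edge of a class at its owner's weight, plus M times a penalty vector h, where M bounds
-- every agent's surplus at the owners' weights. h is 1 on vertices outside a*, the class size minus
-- one on vertices of a class, -2 on edges inside a class and 1 on edges between classes, so that
-- ⟨h, a_X⟩ counts the vertices of X outside a*, the pairs of X in different classes and the pairs
-- of a class split by X. It vanishes on ∅ and on whole classes and is at least 1 otherwise, so only
-- those bundles can give positive surplus; an owner pays exactly its value for its class, and no
-- other agent whose clique contains the class values it more.

module Submission where

open import Defs
open import Level using (Level; _⊔_)
open import Data.Nat using (ℕ; zero; suc; _≥_)
open import Data.Fin using (Fin; zero; suc; _<_; _<?_; _≟_)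
open import Data.Fin.Properties using (all?; any?; <-cmp)
open import Data.Fin.Subset using (Subset; _∈_; _⊆_)
open import Data.Fin.Subset.Properties using (_∈?_; _⊆?_)
open import Data.Vec using (lookup; tabulate)
open import Data.Vec.Properties
  using (tabulate-cong; tabulate∘lookup; lookup∘tabulate; []=⇒lookup; lookup⇒[]=)
open import Data.Bool using (Bool; true; false; _∧_; _xor_; not; if_then_else_)
open import Data.Bool.Properties as Bool
  using ( ∧-conicalˡ; ∧-conicalʳ; ∧-comm; ∧-zeroʳ; ∧-identityʳ
        ; xor-comm; xor-same; not-injective; ¬-not)
open import Data.Maybe as Maybe using (Maybe; just; nothing; is-just; maybe)
import Data.Maybe.Properties as Maybe
open import Data.List as List using (filter; allFin)
import Data.List.Relation.Unary.All as All
open import Data.List.Relation.Unary.All.Properties using (all-filter; tabulate⁻)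
open import Data.List.Membership.Propositional.Properties using (∈-filter⁺; ∈-allFin)
import Data.List.Extrema as Extrema
open import Data.Product using (Σ; ∃; _×_; _,_; proj₁; proj₂)
open import Data.Sum using (inj₁; inj₂)
open import Data.Empty using (⊥-elim)
open import Data.Unit.Polymorphic using (tt)
open import Function using (_∘_; mk⇔)
open import Relation.Nullary using (Dec; yes; no; does; ¬_)
open import Relation.Nullary.Decidable using (_→-dec_; _×-dec_; dec-true; dec-false; does-⇔)
open import Relation.Binary using (TotalOrder; IsTotalOrder)
open import Relation.Binary.Definitions using (DecidableEquality; tri<; tri≈; tri>)
open import Relation.Binary.PropositionalEquality
  using (_≡_; _≢_; refl; sym; trans; cong; subst; subst₂; module ≡-Reasoning)
import Relation.Binary.Reasoning.Setoid as ≈-Reasoning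
import Relation.Binary.Reasoning.PartialOrder as ≤-Reasoning
import Algebra.Properties.CommutativeSemigroup as CommutativeSemigroupProperties
import Algebra.Properties.Group as GroupProperties
import Algebra.Properties.Ring as RingProperties

dec-true⁻¹ : ∀ {p} {P : Set p} (P? : Dec P) → does P? ≡ true → P
dec-true⁻¹ (yes p) _ = p

dec-false⁻¹ : ∀ {p} {P : Set p} (P? : Dec P) → does P? ≡ false → ¬ P
dec-false⁻¹ (no ¬p) _ = ¬p

true≢false : ¬ true ≡ false
true≢false ()

Labelling : ℕ → ℕ → Set
Labelling n m = Fin n → Maybe (Fin m)

_≟ₗ_ : ∀ {m} → DecidableEquality (Maybe (Fin m))
_≟ₗ_ = Maybe.≡-dec _≟_

classOf : ∀ {n m} → Labelling n m → Fin m → Subset n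
classOf o b = tabulate (λ k → does (o k ≟ₗ just b))

ClassWithin : ∀ {n m} → Labelling n m → Fin m → Subset n → Set
ClassWithin o b X = ∀ k → o k ≡ just b → k ∈ X

classWithin? : ∀ {n m} (o : Labelling n m) b X → Dec (ClassWithin o b X)
classWithin? o b X = all? (λ k → (o k ≟ₗ just b) →-dec (k ∈? X))

∈classOf : ∀ {n m} (o : Labelling n m) {b k} → o k ≡ just b → k ∈ classOf o b
∈classOf o {b} {k} ok = lookup⇒[]= k _ (trans (lookup∘tabulate _ k) (dec-true (o k ≟ₗ just b) ok))

∈classOf⁻ : ∀ {n m} (o : Labelling n m) {b k} → k ∈ classOf o b → o k ≡ just b
∈classOf⁻ o {b} {k} k∈ =
  dec-true⁻¹ (o k ≟ₗ just b) (trans (sym (lookup∘tabulate _ k)) ([]=⇒lookup k∈))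

classOf⊆ : ∀ {n m} (o : Labelling n m) {b X} → ClassWithin o b X → classOf o b ⊆ X
classOf⊆ o within k∈ = within _ (∈classOf⁻ o k∈)

count-indicator : ∀ {n} m (T : Fin m → Subset n) i (y : Maybe (Fin m)) →
                  (∀ b → lookup (T b) i ≡ does (y ≟ₗ just b)) → count m T i ≡ bit (is-just y)
count-indicator zero    T i nothing h = refl
count-indicator (suc m) T i y h rewrite h zero with y
... | nothing      = count-indicator m (T ∘ suc) i nothing (h ∘ suc)
... | just zero    = cong suc (count-indicator m (T ∘ suc) i nothing (h ∘ suc))
... | just (suc c) = count-indicator m (T ∘ suc) i (just c) (h ∘ suc)

count-classOf : ∀ {n} m (o : Labelling n m) i → count m (classOf o) i ≡ bit (is-just (o i))
count-classOf m o i = count-indicator m (classOf o) i (o i) (λ b → lookup∘tabulate _ i)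

Covers : ∀ {n m} → (Fin m → Subset n) → (Fin n → Bool) → Set
Covers S A = ∀ i → A i ≡ true → ∃ λ b → i ∈ S b

record IsMaximalPartition {n m} (S : Fin m → Subset n) (A : Fin n → Bool) (own : Labelling n m) : Set where
  field
    labelled≡A  : ∀ i → is-just (own i) ≡ A i
    class⊆owner : ∀ b → ClassWithin own b (S b)
    separated   : ∀ {a b c i j} → own i ≡ just b → own j ≡ just c →
                  ClassWithin own b (S a) → ClassWithin own c (S a) → b ≡ c

coveredBy : ∀ {n m} → (Fin m → Subset n) → Fin n → Bool
coveredBy S i = does (any? (λ b → i ∈? S b))

module AddAgent {n m} (S : Fin (suc m) → Subset n) (A : Fin n → Bool) (covers : Covers S A)
  (own′ : Labelling n m)
  (max′ : IsMaximalPartition (S ∘ suc) (λ i → A i ∧ coveredBy (S ∘ suc) i) own′) where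

  module Max′ = IsMaximalPartition max′

  absorbed : Fin m → Bool
  absorbed c = does (classWithin? own′ c (S zero))

  relabel : Maybe (Fin m) → Bool → Maybe (Fin (suc m))
  relabel nothing  inA = if inA then just zero else nothing
  relabel (just c) _   = if absorbed c then just zero else just (suc c)

  own : Labelling n (suc m)
  own i = relabel (own′ i) (A i)

  data Origin (i : Fin n) : Maybe (Fin (suc m)) → Set where
    fresh     : own′ i ≡ nothing → A i ≡ true → Origin i (just zero)
    outside   : own′ i ≡ nothing → A i ≡ false → Origin i nothing
    swallowed : ∀ {c} → own′ i ≡ just c → absorbed c ≡ true → Origin i (just zero)
    kept      : ∀ {c} → own′ i ≡ just c → absorbed c ≡ false → Origin i (just (suc c))

  origin : ∀ {i y} → own i ≡ y → Origin i y
  origin {i} refl with own′ i in e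
  ... | nothing with A i in a
  ...   | true  = fresh e a
  ...   | false = outside e a
  origin {i} refl | just c with absorbed c in ab
  ...   | true  = swallowed e ab
  ...   | false = kept e ab

  own-kept : ∀ {k c} → own′ k ≡ just c → absorbed c ≡ false → own k ≡ just (suc c)
  own-kept {k} e ab rewrite e | ab = refl

  own-swallowed : ∀ {k c} → own′ k ≡ just c → absorbed c ≡ true → own k ≡ just zero
  own-swallowed {k} e ab rewrite e | ab = refl

  keptClass : ∀ {c X} → absorbed c ≡ false → ClassWithin own (suc c) X → ClassWithin own′ c X
  keptClass ab within k e = within k (own-kept e ab)

  swallowedClass : ∀ {c X} → absorbed c ≡ true → ClassWithin own zero X → ClassWithin own′ c X
  swallowedClass ab within k e = within k (own-swallowed e ab)

  kept⊈S₀ : ∀ {c} → absorbed c ≡ false → ¬ ClassWithin own (suc c) (S zero)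
  kept⊈S₀ ab within = dec-false⁻¹ (classWithin? own′ _ (S zero)) ab (keptClass ab within)

  labelled⇒A : ∀ {i c} → own′ i ≡ just c → A i ≡ true
  labelled⇒A {i} e = ∧-conicalˡ _ _ (trans (sym (Max′.labelled≡A i)) (cong is-just e))

  fresh∉S : ∀ {i b} → own′ i ≡ nothing → A i ≡ true → ¬ i ∈ S (suc b)
  fresh∉S {i} {b} e inA i∈S = true≢false (begin
    true                             ≡⟨ sym (dec-true (any? (λ b → i ∈? S (suc b))) (b , i∈S)) ⟩
    coveredBy (S ∘ suc) i            ≡⟨ cong (_∧ coveredBy (S ∘ suc) i) (sym inA) ⟩
    A i ∧ coveredBy (S ∘ suc) i      ≡⟨ sym (Max′.labelled≡A i) ⟩
    is-just (own′ i)                 ≡⟨ cong is-just e ⟩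
    false                            ∎)
    where open ≡-Reasoning

  fresh∈S₀ : ∀ {i} → own′ i ≡ nothing → A i ≡ true → i ∈ S zero
  fresh∈S₀ {i} e inA with covers i inA
  ... | zero  , i∈S = i∈S
  ... | suc b , i∈S = ⊥-elim (fresh∉S e inA i∈S)

  labelled≡A : ∀ i → is-just (own i) ≡ A i
  labelled≡A i with own i in e
  ... | _ with origin e
  ...   | fresh _ inA    = sym inA
  ...   | outside _ ∉A   = sym ∉A
  ...   | swallowed e′ _ = sym (labelled⇒A e′)
  ...   | kept e′ _      = sym (labelled⇒A e′)

  class⊆owner : ∀ b → ClassWithin own b (S b)
  class⊆owner b k e with origin e
  ... | fresh e′ inA    = fresh∈S₀ e′ inA
  ... | swallowed e′ ab = dec-true⁻¹ (classWithin? own′ _ (S zero)) ab k e′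
  ... | kept e′ _       = Max′.class⊆owner _ k e′

  swallowed∧kept : ∀ {a c i j} → own i ≡ just zero → own j ≡ just (suc c) →
                   ClassWithin own zero (S a) → ¬ ClassWithin own (suc c) (S a)
  swallowed∧kept {zero} _ oj _ within₁ with origin oj
  ... | kept _ ab = kept⊈S₀ ab within₁
  swallowed∧kept {suc a} oi oj within₀ within₁ with origin oi | origin oj
  ... | fresh e inA     | _             = fresh∉S e inA (within₀ _ oi)
  ... | swallowed ei ae | kept ej notAc = true≢false (trans (sym ae) (subst (λ e → absorbed e ≡ false)
          (sym (Max′.separated ei ej (swallowedClass ae within₀) (keptClass notAc within₁))) notAc))

  separated : ∀ {a b c i j} → own i ≡ just b → own j ≡ just c →
              ClassWithin own b (S a) → ClassWithin own c (S a) → b ≡ c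
  separated {b = zero}  {zero}  _  _  _  _  = refl
  separated {b = zero}  {suc c} oi oj w₀ w₁ = ⊥-elim (swallowed∧kept oi oj w₀ w₁)
  separated {b = suc b} {zero}  oi oj w₀ w₁ = ⊥-elim (swallowed∧kept oj oi w₁ w₀)
  separated {zero} {suc b} {suc c} oi _ w₀ _ with origin oi
  ... | kept _ ab = ⊥-elim (kept⊈S₀ ab w₀)
  separated {suc a} {suc b} {suc c} oi oj w₀ w₁ with origin oi | origin oj
  ... | kept ei ab | kept ej ac = cong suc (Max′.separated ei ej (keptClass ab w₀) (keptClass ac w₁))

  isMaximal : IsMaximalPartition S A own
  isMaximal = record { labelled≡A = labelled≡A ; class⊆owner = class⊆owner ; separated = separated }

maximalPartition : ∀ {n} m (S : Fin m → Subset n) (A : Fin n → Bool) → Covers S A →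
                   Σ (Labelling n m) (IsMaximalPartition S A)
maximalPartition zero S A covers = (λ _ → nothing) , record
  { labelled≡A  = λ i → sym (uncovered i)
  ; class⊆owner = λ ()
  ; separated   = λ { {b = ()} }
  }
  where
  uncovered : ∀ i → A i ≡ false
  uncovered i with A i in e
  ... | false = refl
  ... | true with covers i e
  ...   | () , _
maximalPartition (suc m) S A covers =
  let own′ , max′ = maximalPartition m (S ∘ suc) (λ i → A i ∧ coveredBy (S ∘ suc) i) coversRest
  in AddAgent.own S A covers own′ max′ , AddAgent.isMaximal S A covers own′ max′
  where
  coversRest : Covers (S ∘ suc) (λ i → A i ∧ coveredBy (S ∘ suc) i)
  coversRest i e = dec-true⁻¹ (any? (λ b → i ∈? S (suc b))) (∧-conicalʳ _ _ e)

module StableLabelling {c ℓ₁ ℓ₂} (O : TotalOrder c ℓ₁ ℓ₂) {n m}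
  (S : Fin m → Subset n) (A : Fin n → Bool)
  (val : Fin m → Subset n → TotalOrder.Carrier O) where

  open TotalOrder O using (_≤_)
  open Extrema O using (argmax; argmax-all; f[xs]≤f[argmax])

  record IsStable (o : Labelling n m) : Set ℓ₂ where
    field
      labelled≡A  : ∀ i → is-just (o i) ≡ A i
      class⊆owner : ∀ b → ClassWithin o b (S b)
      stable      : ∀ {a b i} → o i ≡ just b → ClassWithin o b (S a) →
                    val a (classOf o b) ≤ val b (classOf o b)

  module _ (covers : Covers S A) where

    private
      own : Labelling n m
      own = proj₁ (maximalPartition m S A covers)

      open IsMaximalPartition (proj₂ (maximalPartition m S A covers))

      eligible? : ∀ b a → Dec (ClassWithin own b (S a))
      eligible? b a = classWithin? own b (S a)

      bestOwner : Fin m → Fin m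
      bestOwner b = argmax (λ a → val a (classOf own b)) b (filter (eligible? b) (allFin m))

      bestOwner-eligible : ∀ b → ClassWithin own b (S (bestOwner b))
      bestOwner-eligible b = argmax-all _ (class⊆owner b) (all-filter (eligible? b) (allFin m))

      bestOwner-best : ∀ {a b} → ClassWithin own b (S a) →
                       val a (classOf own b) ≤ val (bestOwner b) (classOf own b)
      bestOwner-best {a} {b} within = All.lookup (f[xs]≤f[argmax] b _)
        (∈-filter⁺ (eligible? b) (∈-allFin a) within)

      o : Labelling n m
      o = Maybe.map bestOwner ∘ own

      o≡just : ∀ {k x} → o k ≡ just x → ∃ λ b → own k ≡ just b × bestOwner b ≡ x
      o≡just {k} e with own k
      o≡just refl | just b = b , refl , refl

      -- bestOwner is injective on classes, since no clique contains two classes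
      sameClass : ∀ {b i k} → own i ≡ just b → o k ≡ just (bestOwner b) → own k ≡ just b
      sameClass {b} oi ok with o≡just ok
      ... | b′ , ok′ , best≡ = subst (λ b → own _ ≡ just b) (separated ok′ oi within′ (bestOwner-eligible b)) ok′
        where
        within′ : ClassWithin own b′ (S (bestOwner b))
        within′ = subst (ClassWithin own b′ ∘ S) best≡ (bestOwner-eligible b′)

      classOf-o : ∀ {b i} → own i ≡ just b → classOf o (bestOwner b) ≡ classOf own b
      classOf-o {b} oi = tabulate-cong λ k → does-⇔ (mk⇔ (sameClass oi) (cong (Maybe.map bestOwner)))
                                                    (o k ≟ₗ just (bestOwner b)) (own k ≟ₗ just b)

      o-labelled≡A : ∀ i → is-just (o i) ≡ A i
      o-labelled≡A i with own i | labelled≡A i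
      ... | nothing | inA = inA
      ... | just _  | inA = inA

      o-class⊆owner : ∀ x → ClassWithin o x (S x)
      o-class⊆owner x k ok with o≡just ok
      ... | b , ownk , refl = bestOwner-eligible b k ownk

      o-stable : ∀ {a x i} → o i ≡ just x → ClassWithin o x (S a) →
                 val a (classOf o x) ≤ val x (classOf o x)
      o-stable oi within with o≡just oi
      ... | b , owni , refl rewrite classOf-o owni =
        bestOwner-best (λ k ownk → within k (cong (Maybe.map bestOwner) ownk))

    stableLabelling : Σ (Labelling n m) IsStable
    stableLabelling = o , record
      { labelled≡A = o-labelled≡A ; class⊆owner = o-class⊆owner ; stable = o-stable }

data Link : Set where
  same different unlinked : Link

link : ∀ {m} → Maybe (Fin m) → Maybe (Fin m) → Link
link (just a) (just b) = if does (a ≟ b) then same else different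
link _        _        = unlinked

isSame : Link → Bool
isSame same = true
isSame _    = false

link-sym : ∀ {m} (y z : Maybe (Fin m)) → link y z ≡ link z y
link-sym nothing  nothing  = refl
link-sym nothing  (just _) = refl
link-sym (just _) nothing  = refl
link-sym (just a) (just b) = cong (if_then same else different) (does-⇔ (mk⇔ sym sym) (a ≟ b) (b ≟ a))

link-same : ∀ {m} (a : Fin m) → link (just a) (just a) ≡ same
link-same a = cong (if_then same else different) (dec-true (a ≟ a) refl)

link-different : ∀ {m} {a b : Fin m} → a ≢ b → link (just a) (just b) ≡ different
link-different {a = a} {b} a≢b = cong (if_then same else different) (dec-false (a ≟ b) a≢b)

-- violates (link (o i) (o j)) x y: a bundle containing i iff x and j iff y splits the
-- common class of i and j, or meets two different classes.
violates : Link → Bool → Bool → Bool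
violates same      x y = x xor y
violates different x y = x ∧ y
violates unlinked  _ _ = false

violates-sym : ∀ l x y → violates l x y ≡ violates l y x
violates-sym same      = xor-comm
violates-sym different = ∧-comm
violates-sym unlinked  _ _ = refl

violates-diag : ∀ {m} (y : Maybe (Fin m)) x → violates (link y y) x x ≡ false
violates-diag nothing  x = refl
violates-diag (just a) x rewrite link-same a = xor-same x

class-noUnlabelled : ∀ {m} (y : Maybe (Fin m)) b → does (y ≟ₗ just b) ∧ not (is-just y) ≡ false
class-noUnlabelled nothing  _ = refl
class-noUnlabelled (just _) _ = ∧-zeroʳ _

class-noViolation : ∀ {m} (y z : Maybe (Fin m)) b →
                      violates (link y z) (does (y ≟ₗ just b)) (does (z ≟ₗ just b)) ≡ false
class-noViolation nothing  _        b = refl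
class-noViolation (just _) nothing  b = refl
class-noViolation (just c) (just d) b with c ≟ d
... | yes refl = xor-same (does (c ≟ b))
... | no c≢d with c ≟ b | d ≟ b
...   | yes refl | yes refl = ⊥-elim (c≢d refl)
...   | yes _    | no _     = refl
...   | no _     | _        = refl

violationFree⇒member : ∀ {m} {b : Fin m} y x → violates (link (just b) y) true x ≡ false →
                       x ∧ not (is-just y) ≡ false → x ≡ does (y ≟ₗ just b)
violationFree⇒member nothing x _ unlabelled = trans (sym (∧-identityʳ x)) unlabelled
violationFree⇒member {b = b} (just c) x ok _ with c ≟ b
... | yes refl = not-injective (trans (cong (λ l → violates l true x) (sym (link-same c))) ok)
... | no c≢b   = trans (cong (λ l → violates l true x) (sym (link-different (c≢b ∘ sym)))) ok

aS-none : ∀ {n} {X : Subset n} → (∀ i → lookup X i ≡ false) → ∀ k → aS X k ≡ false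
aS-none none (inj₁ i)             = none i
aS-none none (inj₂ ((i , _) , _)) rewrite none i = refl

module OrderedFieldProperties {c ℓ₁ ℓ₂} (F : OrderedField c ℓ₁ ℓ₂) where

  open OrderedField F hiding (zero)
    renaming (refl to ≈-refl; sym to ≈-sym; trans to ≈-trans; _≤_ to infix 4 _≤_)
  open CommutativeSemigroupProperties +-commutativeSemigroup using (interchange)
  open IsTotalOrder isTotalOrder public using (total; ≤-respˡ-≈; ≤-respʳ-≈)
    renaming (refl to ≤-refl; trans to ≤-trans)
  open RingProperties ring using (-1*x≈-x; x[y-z]≈xy-xz)
  open GroupProperties +-group using (⁻¹-involutive)

  totalOrder : TotalOrder c ℓ₁ ℓ₂
  totalOrder = record { isTotalOrder = isTotalOrder }

  open TotalOrder totalOrder public using (poset)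

  +-monoʳ-≤ : ∀ {x y} z → x ≤ y → z + x ≤ z + y
  +-monoʳ-≤ {x} {y} z x≤y = ≤-respʳ-≈ (+-comm y z) (≤-respˡ-≈ (+-comm x z) (+-mono-≤ z x≤y))

  +-mono₂-≤ : ∀ {x y u v} → x ≤ y → u ≤ v → x + u ≤ y + v
  +-mono₂-≤ {y = y} {u} x≤y u≤v = ≤-trans (+-mono-≤ u x≤y) (+-monoʳ-≤ y u≤v)

  +-nonneg : ∀ {x y} → 0# ≤ x → 0# ≤ y → 0# ≤ x + y
  +-nonneg 0≤x 0≤y = ≤-respˡ-≈ (+-identityˡ 0#) (+-mono₂-≤ 0≤x 0≤y)

  x≤x+y : ∀ {x y} → 0# ≤ y → x ≤ x + y
  x≤x+y {x} 0≤y = ≤-respˡ-≈ (+-identityʳ x) (+-monoʳ-≤ x 0≤y)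

  x≤y+x : ∀ {x y} → 0# ≤ y → x ≤ y + x
  x≤y+x {x} {y} 0≤y = ≤-respʳ-≈ (+-comm x y) (x≤x+y 0≤y)

  x-y+y≈x : ∀ x y → x - y + y ≈ x
  x-y+y≈x x y = ≈-trans (+-assoc x (- y) y) (≈-trans (+-cong ≈-refl (-‿inverseˡ y)) (+-identityʳ x))

  x≤y⇒0≤y-x : ∀ {x y} → x ≤ y → 0# ≤ y - x
  x≤y⇒0≤y-x {x} x≤y = ≤-respˡ-≈ (-‿inverseʳ x) (+-mono-≤ (- x) x≤y)

  x≤y⇒x-y≤0 : ∀ {x y} → x ≤ y → x - y ≤ 0#
  x≤y⇒x-y≤0 {y = y} x≤y = ≤-respʳ-≈ (-‿inverseʳ y) (+-mono-≤ (- y) x≤y)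

  0≤y-x⇒x≤y : ∀ {x y} → 0# ≤ y - x → x ≤ y
  0≤y-x⇒x≤y {x} {y} 0≤y-x = ≤-respʳ-≈ (x-y+y≈x y x) (≤-respˡ-≈ (+-identityˡ x) (+-mono-≤ x 0≤y-x))

  x-y≤z⇒x≤y+z : ∀ {x y z} → x - y ≤ z → x ≤ y + z
  x-y≤z⇒x≤y+z {x} {y} {z} x-y≤z = ≤-respˡ-≈ (x-y+y≈x x y) (≤-respʳ-≈ (+-comm z y) (+-mono-≤ y x-y≤z))

  x≈y⇒x-y≈0 : ∀ {x y} → x ≈ y → x - y ≈ 0#
  x≈y⇒x-y≈0 {y = y} x≈y = ≈-trans (+-cong x≈y ≈-refl) (-‿inverseʳ y)

  0≤1 : 0# ≤ 1#
  0≤1 with total 0# 1#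
  ... | inj₁ 0≤1 = 0≤1
  ... | inj₂ 1≤0 = ≤-respʳ-≈ (≈-trans (-1*x≈-x (- 1#)) (⁻¹-involutive 1#)) (*-nonneg 0≤-1 0≤-1)
    where
    0≤-1 : 0# ≤ - 1#
    0≤-1 = ≤-respˡ-≈ (-‿inverseʳ 1#) (≤-respʳ-≈ (+-identityˡ (- 1#)) (+-mono-≤ (- 1#) 1≤0))

  x≤x*y : ∀ {x y} → 0# ≤ x → 1# ≤ y → x ≤ x * y
  x≤x*y {x} {y} 0≤x 1≤y = 0≤y-x⇒x≤y (≤-respʳ-≈ x[y-1]≈xy-x (*-nonneg 0≤x (x≤y⇒0≤y-x 1≤y)))
    where
    x[y-1]≈xy-x : x * (y - 1#) ≈ x * y - x
    x[y-1]≈xy-x = ≈-trans (x[y-z]≈xy-xz x y 1#) (+-cong ≈-refl (-‿cong (*-identityʳ x)))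

  χ : Bool → Carrier
  χ true  = 1#
  χ false = 0#

  χ-nonneg : ∀ b → 0# ≤ χ b
  χ-nonneg true  = 0≤1
  χ-nonneg false = ≤-refl

  when : ∀ {p} {P : Set p} → Dec P → Carrier → Carrier
  when (yes _) x = x
  when (no _)  _ = 0#

  when-nonneg : ∀ {p} {P : Set p} (P? : Dec P) {x} → 0# ≤ x → 0# ≤ when P? x
  when-nonneg (yes _) 0≤x = 0≤x
  when-nonneg (no _)  _   = ≤-refl

  when-yes : ∀ {p} {P : Set p} (P? : Dec P) {x} → P → when P? x ≡ x
  when-yes (yes _) _ = refl
  when-yes (no ¬p) p = ⊥-elim (¬p p)

  when-0 : ∀ {p} {P : Set p} (P? : Dec P) → when P? 0# ≈ 0#
  when-0 (yes _) = ≈-refl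
  when-0 (no _)  = ≈-refl

  sum : ∀ n → (Fin n → Carrier) → Carrier
  sum = sumFin F

  sum-cong : ∀ n {f g : Fin n → Carrier} → (∀ i → f i ≈ g i) → sum n f ≈ sum n g
  sum-cong zero    f≈g = ≈-refl
  sum-cong (suc n) f≈g = +-cong (f≈g zero) (sum-cong n (f≈g ∘ suc))

  sum-zero : ∀ n {f : Fin n → Carrier} → (∀ i → f i ≈ 0#) → sum n f ≈ 0#
  sum-zero zero    f≈0 = ≈-refl
  sum-zero (suc n) f≈0 = ≈-trans (+-cong (f≈0 zero) (sum-zero n (f≈0 ∘ suc))) (+-identityˡ 0#)

  sum-+ : ∀ n (f g : Fin n → Carrier) → sum n (λ i → f i + g i) ≈ sum n f + sum n g
  sum-+ zero    f g = ≈-sym (+-identityˡ 0#)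
  sum-+ (suc n) f g =
    ≈-trans (+-cong ≈-refl (sum-+ n (f ∘ suc) (g ∘ suc))) (interchange (f zero) (g zero) _ _)

  sum-*ˡ : ∀ n x (f : Fin n → Carrier) → sum n (λ i → x * f i) ≈ x * sum n f
  sum-*ˡ zero    x f = ≈-sym (zeroʳ x)
  sum-*ˡ (suc n) x f = ≈-trans (+-cong ≈-refl (sum-*ˡ n x (f ∘ suc))) (≈-sym (distribˡ x _ _))

  sum-mono : ∀ n {f g : Fin n → Carrier} → (∀ i → f i ≤ g i) → sum n f ≤ sum n g
  sum-mono zero    f≤g = ≤-refl
  sum-mono (suc n) f≤g = +-mono₂-≤ (f≤g zero) (sum-mono n (f≤g ∘ suc))

  sum-nonneg : ∀ n {f : Fin n → Carrier} → (∀ i → 0# ≤ f i) → 0# ≤ sum n f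
  sum-nonneg zero    0≤f = ≤-refl
  sum-nonneg (suc n) 0≤f = +-nonneg (0≤f zero) (sum-nonneg n (0≤f ∘ suc))

  term≤sum : ∀ n {f : Fin n → Carrier} → (∀ i → 0# ≤ f i) → ∀ k → f k ≤ sum n f
  term≤sum (suc n) 0≤f zero    = x≤x+y (sum-nonneg n (0≤f ∘ suc))
  term≤sum (suc n) 0≤f (suc k) = ≤-trans (term≤sum n (0≤f ∘ suc) k) (x≤y+x (0≤f zero))

  sum-comm : ∀ n n′ (g : Fin n → Fin n′ → Carrier) →
             sum n (λ i → sum n′ (g i)) ≈ sum n′ (λ j → sum n (λ i → g i j))
  sum-comm zero    n′ g = ≈-sym (sum-zero n′ (λ _ → ≈-refl))
  sum-comm (suc n) n′ g = ≈-trans (+-cong ≈-refl (sum-comm n n′ (g ∘ suc)))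
                                (≈-sym (sum-+ n′ (g zero) (λ j → sum n (λ i → g (suc i) j))))

  sum²-+ : ∀ n n′ (f g : Fin n → Fin n′ → Carrier) →
           sum n (λ i → sum n′ (λ j → f i j + g i j))
             ≈ sum n (λ i → sum n′ (f i)) + sum n (λ i → sum n′ (g i))
  sum²-+ n n′ f g = ≈-trans (sum-cong n (λ i → sum-+ n′ (f i) (g i))) (sum-+ n _ _)

  edgePart : ∀ {n} (f : Idx n → Carrier) (i j : Fin n) → Dec (i < j) → Carrier
  edgePart f i j (yes i<j) = f (inj₂ ((i , j) , i<j))
  edgePart f i j (no _)    = 0#

  edgeSum : ∀ n → (Idx n → Carrier) → Carrier
  edgeSum n f = sum n (λ i → sum n (λ j → edgePart f i j (i <? j)))

  splitIdx : ∀ n → (Idx n → Carrier) → Carrier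
  splitIdx n f = sum n (f ∘ inj₁) + edgeSum n f

  mutual
    sumIdx≈splitIdx : ∀ n (f : Idx n → Carrier) → sumIdx F n f ≈ splitIdx n f
    sumIdx≈splitIdx n f = +-cong ≈-refl (sum-cong n λ i → sum-cong n λ j → edgeTerm≈edgePart n f i j)

    -- The left-hand side is the edge term local to Defs.sumIdx, which cannot be named here.
    edgeTerm≈edgePart : ∀ n (f : Idx n → Carrier) (i j : Fin n) → _ ≈ edgePart f i j (i <? j)
    edgeTerm≈edgePart n f i j with i <? j
    ... | yes _ = ≈-refl
    ... | no _  = ≈-refl

  sumIdx-cong : ∀ n {f g : Idx n → Carrier} → (∀ k → f k ≈ g k) → sumIdx F n f ≈ sumIdx F n g
  sumIdx-cong n {f} {g} f≈g = begin
    sumIdx F n f  ≈⟨ sumIdx≈splitIdx n f ⟩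
    splitIdx n f  ≈⟨ +-cong (sum-cong n (f≈g ∘ inj₁)) (sum-cong n λ i → sum-cong n λ j → edge i j (i <? j)) ⟩
    splitIdx n g  ≈⟨ sumIdx≈splitIdx n g ⟨
    sumIdx F n g  ∎
    where
    open ≈-Reasoning setoid
    edge : ∀ i j d → edgePart f i j d ≈ edgePart g i j d
    edge i j (yes _) = f≈g _
    edge i j (no _)  = ≈-refl

  sumIdx-+ : ∀ n (f g : Idx n → Carrier) → sumIdx F n (λ k → f k + g k) ≈ sumIdx F n f + sumIdx F n g
  sumIdx-+ n f g = begin
    sumIdx F n (λ k → f k + g k)
      ≈⟨ sumIdx≈splitIdx n _ ⟩
    sum n (λ i → f (inj₁ i) + g (inj₁ i)) + edgeSum n (λ k → f k + g k)
      ≈⟨ +-cong (sum-+ n _ _) (≈-trans (sum-cong n λ i → sum-cong n λ j → edge i j (i <? j)) (sum²-+ n n _ _)) ⟩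
    (sum n (f ∘ inj₁) + sum n (g ∘ inj₁)) + (edgeSum n f + edgeSum n g)
      ≈⟨ interchange _ _ _ _ ⟩
    splitIdx n f + splitIdx n g
      ≈⟨ +-cong (sumIdx≈splitIdx n f) (sumIdx≈splitIdx n g) ⟨
    sumIdx F n f + sumIdx F n g
      ∎
    where
    open ≈-Reasoning setoid
    edge : ∀ i j d → edgePart (λ k → f k + g k) i j d ≈ edgePart f i j d + edgePart g i j d
    edge i j (yes _) = ≈-refl
    edge i j (no _)  = ≈-sym (+-identityʳ 0#)

  sumIdx-*ˡ : ∀ n x (f : Idx n → Carrier) → sumIdx F n (λ k → x * f k) ≈ x * sumIdx F n f
  sumIdx-*ˡ n x f = begin
    sumIdx F n (λ k → x * f k)
      ≈⟨ sumIdx≈splitIdx n _ ⟩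
    sum n (λ i → x * f (inj₁ i)) + edgeSum n (λ k → x * f k)
      ≈⟨ +-cong (sum-*ˡ n x _) (sum-cong n λ i → sum-cong n λ j → edge i j (i <? j)) ⟩
    x * sum n (f ∘ inj₁) + sum n (λ i → sum n (λ j → x * edgePart f i j (i <? j)))
      ≈⟨ +-cong ≈-refl (≈-trans (sum-cong n λ i → sum-*ˡ n x _) (sum-*ˡ n x _)) ⟩
    x * sum n (f ∘ inj₁) + x * edgeSum n f
      ≈⟨ distribˡ x _ _ ⟨
    x * splitIdx n f
      ≈⟨ *-cong ≈-refl (sumIdx≈splitIdx n f) ⟨
    x * sumIdx F n f
      ∎
    where
    open ≈-Reasoning setoid
    edge : ∀ i j d → edgePart (λ k → x * f k) i j d ≈ x * edgePart f i j d
    edge i j (yes _) = ≈-refl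
    edge i j (no _)  = ≈-sym (zeroʳ x)

  sumIdx-mono : ∀ n {f g : Idx n → Carrier} → (∀ k → f k ≤ g k) → sumIdx F n f ≤ sumIdx F n g
  sumIdx-mono n {f} {g} f≤g = begin
    sumIdx F n f  ≈⟨ sumIdx≈splitIdx n f ⟩
    splitIdx n f  ≤⟨ +-mono₂-≤ (sum-mono n (f≤g ∘ inj₁)) (sum-mono n λ i → sum-mono n λ j → edge i j (i <? j)) ⟩
    splitIdx n g  ≈⟨ sumIdx≈splitIdx n g ⟨
    sumIdx F n g  ∎
    where
    open ≤-Reasoning poset
    edge : ∀ i j d → edgePart f i j d ≤ edgePart g i j d
    edge i j (yes _) = f≤g _
    edge i j (no _)  = ≤-refl

  sumIdx-zero : ∀ n {f : Idx n → Carrier} → (∀ k → f k ≈ 0#) → sumIdx F n f ≈ 0#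
  sumIdx-zero n f≈0 = ≈-trans (sumIdx-cong n (λ k → ≈-trans (f≈0 k) (≈-sym (zeroˡ 0#))))
                              (≈-trans (sumIdx-*ˡ n 0# (λ _ → 0#)) (zeroˡ _))

  sumIdx-nonneg : ∀ n {f : Idx n → Carrier} → (∀ k → 0# ≤ f k) → 0# ≤ sumIdx F n f
  sumIdx-nonneg n {f} 0≤f = ≤-respˡ-≈ (sumIdx-zero n (λ _ → ≈-refl)) (sumIdx-mono n 0≤f)

  mask : Bool → Carrier → Carrier
  mask b x = if b then x else 0#

  mask-0 : ∀ x → mask x 0# ≈ 0#
  mask-0 true  = ≈-refl
  mask-0 false = ≈-refl

  mask-1 : ∀ x → mask x 1# ≡ χ x
  mask-1 true  = refl
  mask-1 false = refl

  pair-cong-on : ∀ {n} {x y : Idx n → Carrier} a → (∀ k → a k ≡ true → x k ≈ y k) →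
                 pair F x a ≈ pair F y a
  pair-cong-on {n} {x} {y} a x≈y = sumIdx-cong n pointwise
    where
    pointwise : ∀ k → mask (a k) (x k) ≈ mask (a k) (y k)
    pointwise k with a k in ak
    ... | true  = x≈y k ak
    ... | false = ≈-refl

  pair-+ : ∀ {n} (x y : Idx n → Carrier) a → pair F (λ k → x k + y k) a ≈ pair F x a + pair F y a
  pair-+ {n} x y a = ≈-trans (sumIdx-cong n pointwise) (sumIdx-+ n _ _)
    where
    pointwise : ∀ k → mask (a k) (x k + y k) ≈ mask (a k) (x k) + mask (a k) (y k)
    pointwise k with a k
    ... | true  = ≈-refl
    ... | false = ≈-sym (+-identityʳ 0#)

  pair-*ˡ : ∀ {n} z (x : Idx n → Carrier) a → pair F (λ k → z * x k) a ≈ z * pair F x a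
  pair-*ˡ {n} z x a = ≈-trans (sumIdx-cong n pointwise) (sumIdx-*ˡ n z _)
    where
    pointwise : ∀ k → mask (a k) (z * x k) ≈ z * mask (a k) (x k)
    pointwise k with a k
    ... | true  = ≈-refl
    ... | false = ≈-sym (zeroʳ z)

  pair-mono : ∀ {n} {x y : Idx n → Carrier} a → (∀ k → x k ≤ y k) → pair F x a ≤ pair F y a
  pair-mono {n} {x} {y} a x≤y = sumIdx-mono n pointwise
    where
    pointwise : ∀ k → mask (a k) (x k) ≤ mask (a k) (y k)
    pointwise k with a k
    ... | true  = x≤y k
    ... | false = ≤-refl

  pair≤sumIdx : ∀ {n} {x : Idx n → Carrier} a → (∀ k → 0# ≤ x k) → pair F x a ≤ sumIdx F n x
  pair≤sumIdx {n} {x} a 0≤x = sumIdx-mono n pointwise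
    where
    pointwise : ∀ k → mask (a k) (x k) ≤ x k
    pointwise k with a k
    ... | true  = ≤-refl
    ... | false = 0≤x k

  pair-none : ∀ {n} (x : Idx n → Carrier) a → (∀ k → a k ≡ false) → pair F x a ≈ 0#
  pair-none {n} x a none = sumIdx-zero n pointwise
    where
    pointwise : ∀ k → mask (a k) (x k) ≈ 0#
    pointwise k rewrite none k = ≈-refl

module CliqueMarket {c ℓ₁ ℓ₂} (F : OrderedField c ℓ₁ ℓ₂) where

  open OrderedField F hiding (zero)
    renaming (refl to ≈-refl; sym to ≈-sym; trans to ≈-trans; reflexive to ≈-reflexive; _≤_ to infix 4 _≤_)
  open OrderedFieldProperties F
  open Extrema totalOrder using (max; ⊥≤max; xs≤max)

  value : ∀ {n} → CliqueValuation F n → Subset n → Carrier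
  value v X = pair F (CliqueValuation.w v) (aS X)

  cost : ∀ {n} → (Idx n → Carrier) → Subset n → Carrier
  cost p X = pair F p (aS X)

  utility-feasible : ∀ {n} (v : CliqueValuation F n) p {X} → X ⊆ CliqueValuation.Sb v →
                     utility F v p X ≡ fin (value v X - cost p X)
  utility-feasible v p {X} X⊆Sb with X ⊆? CliqueValuation.Sb v
  ... | yes _   = refl
  ... | no X⊈Sb = ⊥-elim (X⊈Sb X⊆Sb)

  zeroSurplus⇒InDemand : ∀ {n} (v : CliqueValuation F n) p {S} → S ⊆ CliqueValuation.Sb v →
                         value v S ≈ cost p S →
                         (∀ T → T ⊆ CliqueValuation.Sb v → value v T ≤ cost p T) →
                         InDemand F v p S
  zeroSurplus⇒InDemand v p S⊆Sb value≈cost noGain T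
    rewrite utility-feasible v p S⊆Sb with T ⊆? CliqueValuation.Sb v
  ... | yes T⊆Sb = ≤-respʳ-≈ (≈-sym (x≈y⇒x-y≈0 value≈cost)) (x≤y⇒x-y≤0 (noGain T T⊆Sb))
  ... | no _     = tt

  linkWeight : Link → Carrier
  linkWeight same      = - (1# + 1#)
  linkWeight different = 1#
  linkWeight unlinked  = 0#

  linkWeight-balance : ∀ l x y →
    mask x (χ (isSame l)) + mask y (χ (isSame l)) + mask (x ∧ y) (linkWeight l) ≈ χ (violates l x y)
  linkWeight-balance same true  true  = -‿inverseʳ (1# + 1#)
  linkWeight-balance same true  false = ≈-trans (+-identityʳ _) (+-identityʳ 1#)
  linkWeight-balance same false true  = ≈-trans (+-identityʳ _) (+-identityˡ 1#)
  linkWeight-balance same false false = ≈-trans (+-identityʳ _) (+-identityʳ 0#)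
  linkWeight-balance different x y = begin
    mask x 0# + mask y 0# + mask (x ∧ y) 1#
      ≈⟨ +-cong (+-cong (mask-0 x) (mask-0 y)) (≈-reflexive (mask-1 (x ∧ y))) ⟩
    0# + 0# + χ (x ∧ y)
      ≈⟨ ≈-trans (+-cong (+-identityʳ 0#) ≈-refl) (+-identityˡ _) ⟩
    χ (x ∧ y)
      ∎
    where open ≈-Reasoning setoid
  linkWeight-balance unlinked x y =
    ≈-trans (+-cong (+-cong (mask-0 x) (mask-0 y)) (mask-0 (x ∧ y)))
            (≈-trans (+-identityʳ _) (+-identityʳ 0#))

  module Pricing {n m} (v : Fin m → CliqueValuation F n) (o : Labelling n m) where

    w : Fin m → Idx n → Carrier
    w b = CliqueValuation.w (v b)

    coordinateOwner : Idx n → Maybe (Fin m)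
    coordinateOwner (inj₁ i)             = o i
    coordinateOwner (inj₂ ((i , j) , _)) = if isSame (link (o i) (o j)) then o i else nothing

    ownPrice : Idx n → Carrier
    ownPrice k = maybe (λ b → w b k) 0# (coordinateOwner k)

    surplusBound : Idx n → Carrier
    surplusBound k = max 0# (List.tabulate (λ a → w a k - ownPrice k))

    M : Carrier
    M = sumIdx F n surplusBound

    sameχ : Fin n → Fin n → Carrier
    sameχ i j = χ (isSame (link (o i) (o j)))

    classmates : Fin n → Carrier
    classmates i = sum n (λ j → when (i <? j) (sameχ i j) + when (j <? i) (sameχ i j))

    penaltyPrice : Idx n → Carrier
    penaltyPrice (inj₁ i)             = maybe (λ _ → classmates i) 1# (o i)
    penaltyPrice (inj₂ ((i , j) , _)) = linkWeight (link (o i) (o j))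

    price : Idx n → Carrier
    price k = ownPrice k + M * penaltyPrice k

    vertexViolated : Subset n → Fin n → Bool
    vertexViolated X i = lookup X i ∧ not (is-just (o i))

    pairViolated : Subset n → Fin n → Fin n → Bool
    pairViolated X i j = violates (link (o i) (o j)) (lookup X i) (lookup X j)

    violations : Subset n → Carrier
    violations X = sum n (λ i → χ (vertexViolated X i))
                 + sum n (λ i → sum n (λ j → when (i <? j) (χ (pairViolated X i j))))

    vertexPenalty-split : ∀ x i →
      mask x (penaltyPrice (inj₁ i))
        ≈ χ (x ∧ not (is-just (o i)))
          + sum n (λ j → mask x (when (i <? j) (sameχ i j)) + mask x (when (j <? i) (sameχ i j)))
    vertexPenalty-split false i =
      ≈-sym (≈-trans (+-cong ≈-refl (sum-zero n (λ _ → +-identityʳ 0#))) (+-identityʳ 0#))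
    vertexPenalty-split true  i with o i
    ... | just _  = ≈-sym (+-identityˡ _)
    ... | nothing = ≈-sym (≈-trans (+-cong ≈-refl (sum-zero n noneSame)) (+-identityʳ 1#))
      where
      noneSame : ∀ j → when (i <? j) 0# + when (j <? i) 0# ≈ 0#
      noneSame j = ≈-trans (+-cong (when-0 (i <? j)) (when-0 (j <? i))) (+-identityʳ 0#)

    pairPenalty≈violation : ∀ X i j (i<?j : Dec (i < j)) →
      mask (lookup X i) (when i<?j (sameχ i j)) + mask (lookup X j) (when i<?j (sameχ j i))
        + edgePart (λ k → mask (aS X k) (penaltyPrice k)) i j i<?j
      ≈ when i<?j (χ (pairViolated X i j))
    pairPenalty≈violation X i j (yes _) rewrite link-sym (o j) (o i) =
      linkWeight-balance (link (o i) (o j)) (lookup X i) (lookup X j)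
    pairPenalty≈violation X i j (no _) =
      ≈-trans (+-identityʳ _) (≈-trans (+-cong (mask-0 (lookup X i)) (mask-0 (lookup X j))) (+-identityʳ 0#))

    -- Every point of X pays 1 for each classmate, to the pair they form; moving the shares paid
    -- to smaller classmates over by sum-comm collects all charges of a pair i < j in one term.
    penalty≈violations : ∀ X → cost penaltyPrice X ≈ violations X
    penalty≈violations X = begin
      cost penaltyPrice X
        ≈⟨ sumIdx≈splitIdx n _ ⟩
      sum n (λ i → mask (x i) (penaltyPrice (inj₁ i))) + sum² E
        ≈⟨ +-cong (≈-trans (sum-cong n (λ i → vertexPenalty-split (x i) i))
                           (≈-trans (sum-+ n _ _) (+-cong ≈-refl (sum²-+ n n R L)))) ≈-refl ⟩
      (sum n V + (sum² R + sum² L)) + sum² E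
        ≈⟨ +-cong (+-cong ≈-refl (+-cong ≈-refl (sum-comm n n L))) ≈-refl ⟩
      (sum n V + (sum² R + sum² (λ i j → L j i))) + sum² E
        ≈⟨ ≈-trans (+-assoc _ _ _)
                   (+-cong ≈-refl (≈-sym (≈-trans (sum²-+ n n _ E) (+-cong (sum²-+ n n R _) ≈-refl)))) ⟩
      sum n V + sum² (λ i j → R i j + L j i + E i j)
        ≈⟨ +-cong ≈-refl (sum-cong n λ i → sum-cong n λ j → pairPenalty≈violation X i j (i <? j)) ⟩
      violations X ∎
      where
      open ≈-Reasoning setoid
      x : Fin n → Bool
      x = lookup X
      sum² : (Fin n → Fin n → Carrier) → Carrier
      sum² f = sum n (λ i → sum n (f i))
      V : Fin n → Carrier
      V i = χ (vertexViolated X i)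
      R L E : Fin n → Fin n → Carrier
      R i j = mask (x i) (when (i <? j) (sameχ i j))
      L i j = mask (x i) (when (j <? i) (sameχ i j))
      E i j = edgePart (λ k → mask (aS X k) (penaltyPrice k)) i j (i <? j)

    cost-price : ∀ X → cost price X ≈ cost ownPrice X + M * violations X
    cost-price X = ≈-trans (pair-+ ownPrice _ (aS X))
      (+-cong ≈-refl (≈-trans (pair-*ˡ M penaltyPrice (aS X)) (*-cong ≈-refl (penalty≈violations X))))

    surplusBound-nonneg : ∀ k → 0# ≤ surplusBound k
    surplusBound-nonneg k = ⊥≤max 0# (List.tabulate (λ a → w a k - ownPrice k))

    M-nonneg : 0# ≤ M
    M-nonneg = sumIdx-nonneg n surplusBound-nonneg

    w≤ownPrice+surplusBound : ∀ a k → w a k ≤ ownPrice k + surplusBound k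
    w≤ownPrice+surplusBound a k =
      x-y≤z⇒x≤y+z (tabulate⁻ (xs≤max 0# (List.tabulate (λ a → w a k - ownPrice k))) a)

    value≤ownCost+M : ∀ a X → value (v a) X ≤ cost ownPrice X + M
    value≤ownCost+M a X = begin
      value (v a) X                                      ≤⟨ pair-mono (aS X) (w≤ownPrice+surplusBound a) ⟩
      pair F (λ k → ownPrice k + surplusBound k) (aS X)  ≈⟨ pair-+ ownPrice surplusBound (aS X) ⟩
      cost ownPrice X + cost surplusBound X
        ≤⟨ +-monoʳ-≤ _ (pair≤sumIdx (aS X) surplusBound-nonneg) ⟩
      cost ownPrice X + M                                ∎
      where open ≤-Reasoning poset

    coordinateOwner-class : ∀ {b} k → aS (classOf o b) k ≡ true → coordinateOwner k ≡ just b
    coordinateOwner-class (inj₁ i) i∈ = ∈classOf⁻ o (lookup⇒[]= i _ i∈)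
    coordinateOwner-class {b} (inj₂ ((i , j) , _)) ij∈
      rewrite ∈classOf⁻ o (lookup⇒[]= i _ (∧-conicalˡ _ _ ij∈))
            | ∈classOf⁻ o (lookup⇒[]= j _ (∧-conicalʳ _ _ ij∈))
            | link-same b = refl

    ownCost-class : ∀ b → cost ownPrice (classOf o b) ≈ value (v b) (classOf o b)
    ownCost-class b = pair-cong-on (aS (classOf o b)) pointwise
      where
      pointwise : ∀ k → aS (classOf o b) k ≡ true → ownPrice k ≈ w b k
      pointwise k k∈ rewrite coordinateOwner-class k k∈ = ≈-refl

    vertexTerm-nonneg : ∀ X i → 0# ≤ χ (vertexViolated X i)
    vertexTerm-nonneg X i = χ-nonneg (vertexViolated X i)

    pairTerm-nonneg : ∀ X i j → 0# ≤ when (i <? j) (χ (pairViolated X i j))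
    pairTerm-nonneg X i j = when-nonneg (i <? j) (χ-nonneg (pairViolated X i j))

    pairTerms-nonneg : ∀ X i → 0# ≤ sum n (λ j → when (i <? j) (χ (pairViolated X i j)))
    pairTerms-nonneg X i = sum-nonneg n (pairTerm-nonneg X i)

    violations-nonneg : ∀ X → 0# ≤ violations X
    violations-nonneg X = +-nonneg (sum-nonneg n (vertexTerm-nonneg X)) (sum-nonneg n (pairTerms-nonneg X))

    vertexViolated⇒1≤violations : ∀ {X i} → vertexViolated X i ≡ true → 1# ≤ violations X
    vertexViolated⇒1≤violations {X} {i} violated = begin
      1#                                      ≡⟨ cong χ violated ⟨
      χ (vertexViolated X i)                  ≤⟨ term≤sum n (vertexTerm-nonneg X) i ⟩
      sum n (λ i → χ (vertexViolated X i))    ≤⟨ x≤x+y (sum-nonneg n (pairTerms-nonneg X)) ⟩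
      violations X                            ∎
      where open ≤-Reasoning poset

    pairViolated⇒1≤violations : ∀ {X i j} → i < j → pairViolated X i j ≡ true → 1# ≤ violations X
    pairViolated⇒1≤violations {X} {i} {j} i<j violated = begin
      1#                                                    ≡⟨ cong χ violated ⟨
      χ (pairViolated X i j)                                ≡⟨ when-yes (i <? j) i<j ⟨
      when (i <? j) (χ (pairViolated X i j))                ≤⟨ term≤sum n (pairTerm-nonneg X i) j ⟩
      sum n (λ j → when (i <? j) (χ (pairViolated X i j)))  ≤⟨ term≤sum n (pairTerms-nonneg X) i ⟩
      sum n (λ i → sum n (λ j → when (i <? j) (χ (pairViolated X i j))))
        ≤⟨ x≤y+x (sum-nonneg n (vertexTerm-nonneg X)) ⟩
      violations X                                          ∎
      where open ≤-Reasoning poset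

    violations-class : ∀ b → violations (classOf o b) ≈ 0#
    violations-class b =
      ≈-trans (+-cong (sum-zero n vertexFree) (sum-zero n λ i → sum-zero n (pairFree i))) (+-identityʳ 0#)
      where
      member : ∀ k → lookup (classOf o b) k ≡ does (o k ≟ₗ just b)
      member = lookup∘tabulate (λ k → does (o k ≟ₗ just b))
      vertexFree : ∀ i → χ (vertexViolated (classOf o b) i) ≈ 0#
      vertexFree i rewrite member i | class-noUnlabelled (o i) b = ≈-refl
      pairFree : ∀ i j → when (i <? j) (χ (pairViolated (classOf o b) i j)) ≈ 0#
      pairFree i j rewrite member i | member j | class-noViolation (o i) (o j) b = when-0 (i <? j)

    data Shape (X : Subset n) : Set (c ⊔ ℓ₂) where
      violating  : 1# ≤ violations X → Shape X
      empty      : (∀ i → lookup X i ≡ false) → Shape X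
      wholeClass : ∀ {b i} → o i ≡ just b → X ≡ classOf o b → Shape X

    pairViolated-sym : ∀ X i j → pairViolated X i j ≡ pairViolated X j i
    pairViolated-sym X i j rewrite link-sym (o i) (o j) =
      violates-sym (link (o j) (o i)) (lookup X i) (lookup X j)

    orderedPairsFree⇒pairsFree : ∀ {X} → (∀ i j → i < j → pairViolated X i j ≡ false) →
                                  ∀ i j → pairViolated X i j ≡ false
    orderedPairsFree⇒pairsFree {X} free i j with <-cmp i j
    ... | tri< i<j _ _ = free i j i<j
    ... | tri≈ _ refl _ = violates-diag (o i) (lookup X i)
    ... | tri> _ _ j<i = trans (pairViolated-sym X i j) (free j i j<i)

    violationFree-shape : ∀ X → (∀ i → vertexViolated X i ≡ false) → (∀ i j → pairViolated X i j ≡ false) →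
                          Shape X
    violationFree-shape X vertexFree pairFree with any? (λ i → lookup X i Bool.≟ true)
    ... | no noMember = empty (λ i → ¬-not (λ i∈X → noMember (i , i∈X)))
    ... | yes (i , i∈X) with o i in oi
    ...   | nothing =
      ⊥-elim (true≢false (subst₂ (λ x y → x ∧ not (is-just y) ≡ false) i∈X oi (vertexFree i)))
    ...   | just b  = wholeClass oi (trans (sym (tabulate∘lookup X)) (tabulate-cong member))
      where
      member : ∀ k → lookup X k ≡ does (o k ≟ₗ just b)
      member k = violationFree⇒member (o k) (lookup X k)
        (subst₂ (λ y x → violates (link y (o k)) x (lookup X k) ≡ false) oi i∈X (pairFree i k)) (vertexFree k)

    shape : ∀ X → Shape X
    shape X with any? (λ i → vertexViolated X i Bool.≟ true)
    ... | yes (i , violated) = violating (vertexViolated⇒1≤violations {X} violated)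
    ... | no vertexFree with any? (λ i → any? (λ j → (i <? j) ×-dec (pairViolated X i j Bool.≟ true)))
    ...   | yes (i , j , i<j , violated) = violating (pairViolated⇒1≤violations {X} i<j violated)
    ...   | no pairFree = violationFree-shape X
      (λ i → ¬-not (λ violated → vertexFree (i , violated)))
      (orderedPairsFree⇒pairsFree {X} (λ i j i<j → ¬-not (λ violated → pairFree (i , j , i<j , violated))))

    Sb : Fin m → Subset n
    Sb b = CliqueValuation.Sb (v b)

    module _ (class⊆owner : ∀ b → ClassWithin o b (Sb b))
             (stable : ∀ {a b i} → o i ≡ just b → ClassWithin o b (Sb a) →
                       value (v a) (classOf o b) ≤ value (v b) (classOf o b)) where

      value≤cost-byShape : ∀ a T → T ⊆ Sb a → Shape T →
                           value (v a) T ≤ cost ownPrice T + M * violations T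
      value≤cost-byShape a T _ (violating 1≤violations) =
        ≤-trans (value≤ownCost+M a T) (+-monoʳ-≤ _ (x≤x*y M-nonneg 1≤violations))
      value≤cost-byShape a T _ (empty none) = begin
        value (v a) T                       ≈⟨ pair-none _ (aS T) (aS-none none) ⟩
        0#                                  ≈⟨ pair-none ownPrice (aS T) (aS-none none) ⟨
        cost ownPrice T                     ≤⟨ x≤x+y (*-nonneg M-nonneg (violations-nonneg T)) ⟩
        cost ownPrice T + M * violations T  ∎
        where open ≤-Reasoning poset
      value≤cost-byShape a _ T⊆Sb (wholeClass {b} oi refl) = begin
        value (v a) (classOf o b)    ≤⟨ stable oi (λ k ok → T⊆Sb (∈classOf o ok)) ⟩
        value (v b) (classOf o b)    ≈⟨ ownCost-class b ⟨
        cost ownPrice (classOf o b)  ≤⟨ x≤x+y (*-nonneg M-nonneg (violations-nonneg (classOf o b))) ⟩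
        cost ownPrice (classOf o b) + M * violations (classOf o b) ∎
        where open ≤-Reasoning poset

      value≤cost : ∀ a T → T ⊆ Sb a → value (v a) T ≤ cost price T
      value≤cost a T T⊆Sb = ≤-respʳ-≈ (≈-sym (cost-price T)) (value≤cost-byShape a T T⊆Sb (shape T))

      value≈cost-class : ∀ a → value (v a) (classOf o a) ≈ cost price (classOf o a)
      value≈cost-class a = begin
        value (v a) (classOf o a)                                  ≈⟨ ownCost-class a ⟨
        cost ownPrice (classOf o a)                                ≈⟨ +-identityʳ _ ⟨
        cost ownPrice (classOf o a) + 0#
          ≈⟨ +-cong ≈-refl (≈-trans (*-cong ≈-refl (violations-class a)) (zeroʳ M)) ⟨
        cost ownPrice (classOf o a) + M * violations (classOf o a) ≈⟨ cost-price (classOf o a) ⟨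
        cost price (classOf o a)                                   ∎
        where open ≈-Reasoning setoid

      classOf-inDemand : ∀ a → InDemand F (v a) price (classOf o a)
      classOf-inDemand a =
        zeroSurplus⇒InDemand (v a) price (classOf⊆ o (class⊆owner a)) (value≈cost-class a) (value≤cost a)

theorem3p4 : ∀ {c ℓ₁ ℓ₂ : Level} (F : OrderedField c ℓ₁ ℓ₂) (n m : ℕ) → n ≥ 1 → m ≥ 1 →
    (v : Fin m → CliqueValuation F n) →
    (∀ (i : Fin n) → ∃ (λ (b : Fin m) → i ∈ CliqueValuation.Sb (v b))) →
    (aStar : Subset n) →
    Σ (Idx n → OrderedField.Carrier F) (λ p →
      Σ (Fin m → Subset n) (λ T →
        (∀ (b : Fin m) → InDemand F (v b) p (T b)) ×
        (∀ (i : Fin n) → count m T i ≡ bit (lookup aStar i))))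
theorem3p4 F n m _ _ v covers aStar =
  price , classOf o , classOf-inDemand class⊆owner stable ,
  λ i → trans (count-classOf m o i) (cong bit (labelled≡A i))
  where
  open OrderedFieldProperties F using (totalOrder)
  open CliqueMarket F using (value; module Pricing)
  open StableLabelling totalOrder (CliqueValuation.Sb ∘ v) (lookup aStar) (value ∘ v)

  labelling : Σ (Labelling n m) IsStable
  labelling = stableLabelling (λ i _ → covers i)

  o : Labelling n m
  o = proj₁ labelling

  open IsStable (proj₂ labelling)
  open Pricing v o
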